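{- For each integer $n\geqslant 6$, write $n=4s+\epsilon$ with $s$ an integer and $\epsilon\in\{0,1,2,3\}$. Then $$\vartheta(T_n)=\begin{cases}1, & \epsilon=0;\\ (2s+1)\lambda, & \epsilon=1;\\ -1, & \epsilon=2;\\ -2(s+1)\lambda, & \epsilon=3.\end{cases}$$
   Context: All graphs are finite, simple and undirected; $\phi(G,\lambda)=\det(\lambda I-A(G))$ is the adjacency characteristic polynomial, and the lowest term $\vartheta(G)$ is the nonzero monomial of lowest degree in $\phi(G,\lambda)$. For $r\geqslant 2$, $P_r$ is the path with vertices $0,1,\dots,r-1$ (consecutive integers adjacent). For $n\geqslant 6$, $T_n$ is the tree obtained from $P_{n-2}$ by attaching at vertex $2$ a pendant path with $2$ edges (so $T_n$ has $n$ vertices). -}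

module Defs where

open import Data.Bool using (Bool; true; false; if_then_else_; _∨_; _∧_)
open import Data.Nat using (ℕ; zero; suc; _∸_; _≡ᵇ_; _<ᵇ_)
open import Data.Integer using (ℤ; +_; -_; _+_; _*_; 0ℤ; 1ℤ)
open import Data.Fin using (Fin; toℕ; punchIn) renaming (zero to fzero; suc to fsuc)
open import Data.List using (List; []; _∷_; map)
open import Data.Maybe using (Maybe; just; nothing)
open import Data.Product using (_×_; _,_)

-- Polynomials in λ with integer coefficients, as coefficient lists
-- (little-endian: the i-th entry is the coefficient of λ^i).

Poly : Set
Poly = List ℤ

_⊕_ : Poly → Poly → Poly
[] ⊕ q = q
(a ∷ p) ⊕ [] = a ∷ p
(a ∷ p) ⊕ (b ∷ q) = (a + b) ∷ (p ⊕ q)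

scale : ℤ → Poly → Poly
scale c = map (c *_)

_⊗_ : Poly → Poly → Poly
[] ⊗ q = []
(a ∷ p) ⊗ q = scale a q ⊕ (0ℤ ∷ (p ⊗ q))

const : ℤ → Poly
const c = c ∷ []

X : Poly
X = 0ℤ ∷ 1ℤ ∷ []

sign : ℕ → ℤ
sign zero = 1ℤ
sign (suc k) = - sign k

det : (n : ℕ) → (Fin n → Fin n → Poly) → Poly
det zero M = const 1ℤ
det (suc n) M = go (suc n) (λ j → j)
  where
  minor : Fin (suc n) → Fin n → Fin n → Poly
  minor j r c = M (fsuc r) (punchIn j c)
  go : (k : ℕ) → (Fin k → Fin (suc n)) → Poly
  go zero f = []
  go (suc k) f =
    (scale (sign (toℕ (f fzero))) (M fzero (f fzero) ⊗ det n (minor (f fzero))))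
    ⊕ go k (λ i → f (fsuc i))

-- Graphs on vertex set Fin n given by a (symmetric, loopless) 0/1
-- adjacency function.  Characteristic polynomial φ(G,λ) = det(λI − A(G)).

Adj : ℕ → Set
Adj n = Fin n → Fin n → Bool

_≟ᶠ_ : {n : ℕ} → Fin n → Fin n → Bool
i ≟ᶠ j = toℕ i ≡ᵇ toℕ j

charPoly : (n : ℕ) → Adj n → Poly
charPoly n A = det n (λ i j →
  (if i ≟ᶠ j then X else []) ⊕ (if A i j then const (- 1ℤ) else []))

-- Lowest term ϑ: the nonzero monomial of lowest degree, returned as
-- (degree , coefficient); nothing for the zero polynomial.

lowestFrom : ℕ → Poly → Maybe (ℕ × ℤ)
lowestFrom d [] = nothing
lowestFrom d (+ 0 ∷ p) = lowestFrom (suc d) p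
lowestFrom d (c ∷ p) = just (d , c)

lowestTerm : Poly → Maybe (ℕ × ℤ)
lowestTerm = lowestFrom 0

-- The tree T_n (n ≥ 6): the path P_{n-2} on vertices 0,…,n-3 (i ~ i+1),
-- plus vertices n-2 and n-1 forming the pendant path 2 — (n-2) — (n-1).

edgeT : ℕ → ℕ → ℕ → Bool
edgeT n a b =
     ((suc a ≡ᵇ b) ∧ (b <ᵇ (n ∸ 2)))
  ∨ ((a ≡ᵇ 2) ∧ (b ≡ᵇ (n ∸ 2)))
  ∨ ((a ≡ᵇ (n ∸ 2)) ∧ (b ≡ᵇ (n ∸ 1)))

T : (n : ℕ) → Adj n
T n i j = edgeT n (toℕ i) (toℕ j) ∨ edgeT n (toℕ j) (toℕ i)

{-# OPTIONS --safe #-}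
-- Only the coefficients of λ⁰ and λ¹ matter, so φ(Tₙ, λ) is computed modulo λ², as the determinant
-- of λI − A over the dual numbers ℤ[ε] (ε² = 0).  Vertex n−1 is a leaf hanging off n−2, and expanding
-- along its row gives φ(Tₙ) = λ φ(Tₙ − (n−1)) − φ(P_{n−2}).  The first determinant is only needed
-- modulo λ; there, expanding along the row of n−2 (a leaf hanging off 2), removing the leaves 0 and 1,
-- and expanding along the row of 2 leaves the path on 3, …, n−3, so φ(Tₙ) ≡ λ φ(P_{n−5}) − φ(P_{n−2}).
-- Finally φ(P_{k+2}) = λ φ(P_{k+1}) − φ(P_k) makes φ(P_k) mod λ² run through 1, (2t+1)λ, −1, −(2t+2)λ
-- for k = 4t, …, 4t+3.
module Submission where

open import Algebra.Bundles using (CommutativeRing)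
open import Data.Fin using (Fin; zero; suc; toℕ; punchIn; punchOut; _≟_; fromℕ<)
open import Data.Fin.Properties using (punchIn-punchOut; punchInᵢ≢i; toℕ<n; toℕ-fromℕ<; toℕ-injective)
open import Data.Nat using (ℕ; zero; suc; _<_; _≤_; s≤s)
open import Data.Product using (Σ-syntax; _×_; _,_)
open import Data.Vec.Functional using (Vector; updateAt)
open import Data.Vec.Functional.Properties using (updateAt-updates; updateAt-minimal)
open import Relation.Binary.PropositionalEquality as ≡ using (_≡_; _≢_)
open import Relation.Nullary using (Dec; yes; no; contradiction)

skip : ℕ → ℕ → ℕ
skip zero    b       = suc b
skip (suc a) zero    = zero
skip (suc a) (suc b) = suc (skip a b)

toℕ-punchIn : ∀ {n} (i : Fin (suc n)) j → toℕ (punchIn i j) ≡ skip (toℕ i) (toℕ j)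
toℕ-punchIn zero    j       = ≡.refl
toℕ-punchIn (suc i) zero    = ≡.refl
toℕ-punchIn (suc i) (suc j) = ≡.cong suc (toℕ-punchIn i j)

skip-< : ∀ {a b} → b < a → skip a b ≡ b
skip-< {suc a} {zero}  _         = ≡.refl
skip-< {suc a} {suc b} (s≤s b<a) = ≡.cong suc (skip-< b<a)

skip-≥ : ∀ {a b} → a ≤ b → skip a b ≡ suc b
skip-≥ {zero}  {b}     _         = ≡.refl
skip-≥ {suc a} {suc b} (s≤s a≤b) = ≡.cong suc (skip-≥ a≤b)

module Determinant {c ℓ} (R : CommutativeRing c ℓ) where

  open CommutativeRing R hiding (zero)
  open import Algebra.Properties.Ring ring using (-‿distribˡ-*; -‿distribʳ-*; -‿involutive; -1*x≈-x)
  open import Algebra.Properties.Semiring.Sum semiring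
    using (sum; sum-cong-≋; sum-replicate-zero; sum-remove; ∑-distrib-+; *-distribˡ-sum)
  open import Algebra.Solver.Ring.NaturalCoefficients.Default commutativeSemiring
    using (solve; _:+_; _:*_; _:=_)
  open import Relation.Binary.Reasoning.Setoid setoid

  Matrix : ℕ → Set c
  Matrix n = Fin n → Fin n → Carrier

  sign : ℕ → Carrier
  sign zero    = 1#
  sign (suc k) = - sign k

  minor : ∀ {n} → Matrix (suc n) → Fin (suc n) → Fin (suc n) → Matrix n
  minor M i j r s = M (punchIn i r) (punchIn j s)

  sum-zero : ∀ {n} (t : Vector Carrier n) → (∀ j → t j ≈ 0#) → sum t ≈ 0#
  sum-zero {n} t t≈0 = trans (sum-cong-≋ t≈0) (sum-replicate-zero n)

  sum-single : ∀ {n} (t : Vector Carrier (suc n)) i → (∀ s → t (punchIn i s) ≈ 0#) → sum t ≈ t i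
  sum-single t i rest≈0 = begin
    sum t                             ≈⟨ sum-remove {i = i} t ⟩
    t i + sum (λ s → t (punchIn i s)) ≈⟨ +-congˡ (sum-zero _ rest≈0) ⟩
    t i + 0#                          ≈⟨ +-identityʳ (t i) ⟩
    t i                               ∎

  sum-linear : ∀ {n} (t u v : Vector Carrier n) a b → (∀ j → t j ≈ a * u j + b * v j) →
               sum t ≈ a * sum u + b * sum v
  sum-linear {n} t u v a b t≈ = begin
    sum t                                         ≈⟨ sum-cong-≋ t≈ ⟩
    sum (λ j → a * u j + b * v j)                 ≈⟨ ∑-distrib-+ (λ j → a * u j) (λ j → b * v j) ⟩
    sum (λ j → a * u j) + sum (λ j → b * v j)     ≈⟨ +-cong (*-distribˡ-sum a u) (*-distribˡ-sum b v) ⟨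
    a * sum u + b * sum v                         ∎

  -x*-y≈x*y : ∀ x y → - x * - y ≈ x * y
  -x*-y≈x*y x y = begin
    - x * - y     ≈⟨ -‿distribˡ-* x (- y) ⟨
    - (x * - y)   ≈⟨ -‿cong (-‿distribʳ-* x y) ⟨
    - - (x * y)   ≈⟨ -‿involutive (x * y) ⟩
    x * y         ∎

  sign-square : ∀ k → sign k * sign k ≈ 1#
  sign-square zero    = *-identityˡ 1#
  sign-square (suc k) = trans (-x*-y≈x*y (sign k) (sign k)) (sign-square k)

  unitVector : ∀ {n} → Fin n → Vector Carrier n
  unitVector c = updateAt (λ _ → 0#) c (λ _ → 1#)

  indexed : ∀ n → (ℕ → ℕ → Carrier) → Matrix n
  indexed n f i j = f (toℕ i) (toℕ j)

  strike : ℕ → ℕ → (ℕ → ℕ → Carrier) → ℕ → ℕ → Carrier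
  strike i c f a b = f (skip i a) (skip c b)

  -- Abstract (det-empty and det-expand are its defining equations): unfolding it in conversion checks
  -- on matrices of concrete size blows up exponentially.
  abstract
    det : ∀ n → Matrix n → Carrier
    det zero    M = 1#
    det (suc n) M = sum λ j → M zero j * (sign 0 * sign (toℕ j) * det n (minor M zero j))

  cofactor : ∀ {n} → Matrix (suc n) → Fin (suc n) → Fin (suc n) → Carrier
  cofactor {n} M i j = sign (toℕ i) * sign (toℕ j) * det n (minor M i j)

  abstract
    det-empty : ∀ (M : Matrix 0) → det 0 M ≈ 1#
    det-empty M = refl

    det-expand : ∀ {n} (M : Matrix (suc n)) → det (suc n) M ≈ sum λ j → M zero j * cofactor M zero j
    det-expand M = refl

    mutual
      det-cong : ∀ n {M N : Matrix n} → (∀ r s → M r s ≈ N r s) → det n M ≈ det n N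
      det-cong zero    M≈N = refl
      det-cong (suc n) {M} {N} M≈N =
        sum-cong-≋ {suc n} λ j → *-cong (M≈N zero j) (cofactor-cong zero j {M} {N} λ r → M≈N (suc r))

      cofactor-cong : ∀ {n} i j {M N : Matrix (suc n)} →
                      (∀ r s → M (punchIn i r) s ≈ N (punchIn i r) s) → cofactor M i j ≈ cofactor N i j
      cofactor-cong {n} i j M≈N = *-congˡ (det-cong n λ r s → M≈N r (punchIn j s))

    det-zeroColumn : ∀ {n} (M : Matrix (suc n)) c → (∀ r → M r c ≈ 0#) → det (suc n) M ≈ 0#
    det-zeroColumn {zero}  M zero col≈0 =
      sum-zero (λ j → M zero j * cofactor M zero j) λ { zero → trans (*-congʳ (col≈0 zero)) (zeroˡ _) }
    det-zeroColumn {suc n} M c    col≈0 = sum-zero _ λ j → term≈0 j (j ≟ c)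
      where
      term≈0 : ∀ j → Dec (j ≡ c) → M zero j * cofactor M zero j ≈ 0#
      term≈0 j (yes ≡.refl) = trans (*-congʳ (col≈0 zero)) (zeroˡ _)
      term≈0 j (no j≢c)     = trans (*-congˡ (trans (*-congˡ minor≈0) (zeroʳ _))) (zeroʳ _)
        where
        minor≈0 : det (suc n) (minor M zero j) ≈ 0#
        minor≈0 = det-zeroColumn (minor M zero j) (punchOut j≢c) λ r →
          trans (reflexive (≡.cong (M (suc r)) (punchIn-punchOut j≢c))) (col≈0 (suc r))

    det-linearRow : ∀ {n} (i : Fin (suc n)) (M U V : Matrix (suc n)) a b →
                    (∀ r s → M (punchIn i r) s ≈ U (punchIn i r) s) →
                    (∀ r s → M (punchIn i r) s ≈ V (punchIn i r) s) →
                    (∀ s → M i s ≈ a * U i s + b * V i s) →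
                    det (suc n) M ≈ a * det (suc n) U + b * det (suc n) V
    det-linearRow zero M U V a b M≈U M≈V row = sum-linear _ _ _ a b λ j → begin
      M zero j * cofactor M zero j                                    ≈⟨ *-congʳ (row j) ⟩
      (a * U zero j + b * V zero j) * cofactor M zero j               ≈⟨ distribʳ _ _ _ ⟩
      a * U zero j * cofactor M zero j + b * V zero j * cofactor M zero j
        ≈⟨ +-cong (*-cong (refl {a * U zero j}) (cofactor-cong zero j {M} {U} M≈U))
                  (*-cong (refl {b * V zero j}) (cofactor-cong zero j {M} {V} M≈V)) ⟩
      a * U zero j * cofactor U zero j + b * V zero j * cofactor V zero j
        ≈⟨ +-cong (*-assoc _ _ _) (*-assoc _ _ _) ⟩
      a * (U zero j * cofactor U zero j) + b * (V zero j * cofactor V zero j) ∎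
    det-linearRow {suc n} (suc i) M U V a b M≈U M≈V row = sum-linear _ _ _ a b λ j → begin
      M zero j * (k j * det (suc n) (minor M zero j))
        ≈⟨ *-congˡ (*-congˡ (det-linearRow i (minor M zero j) (minor U zero j) (minor V zero j) a b
                               (λ r s → M≈U (suc r) _) (λ r s → M≈V (suc r) _) λ s → row _)) ⟩
      M zero j * (k j * (a * det (suc n) (minor U zero j) + b * det (suc n) (minor V zero j)))
        ≈⟨ distribute (M zero j) (k j) a b _ _ ⟩
      a * (M zero j * (k j * det (suc n) (minor U zero j))) + b * (M zero j * (k j * det (suc n) (minor V zero j)))
        ≈⟨ +-cong (*-congˡ (*-congʳ (M≈U zero j))) (*-congˡ (*-congʳ (M≈V zero j))) ⟩
      a * (U zero j * cofactor U zero j) + b * (V zero j * cofactor V zero j) ∎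
      where
      k : Fin (suc (suc n)) → Carrier
      k j = sign 0 * sign (toℕ j)
      distribute : ∀ x y a b p q → x * (y * (a * p + b * q)) ≈ a * (x * (y * p)) + b * (x * (y * q))
      distribute = solve 6 (λ x y a b p q → x :* (y :* (a :* p :+ b :* q)) := a :* (x :* (y :* p)) :+ b :* (x :* (y :* q))) refl

    det-zeroRow : ∀ {n} (M : Matrix (suc n)) i → (∀ s → M i s ≈ 0#) → det (suc n) M ≈ 0#
    det-zeroRow {n} M i row≈0 = begin
      det (suc n) M                             ≈⟨ det-linearRow i M M M 0# 0# (λ _ _ → refl) (λ _ _ → refl) row ⟩
      0# * det (suc n) M + 0# * det (suc n) M   ≈⟨ +-cong (zeroˡ _) (zeroˡ _) ⟩
      0# + 0#                                   ≈⟨ +-identityˡ 0# ⟩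
      0#                                        ∎
      where
      row : ∀ s → M i s ≈ 0# * M i s + 0# * M i s
      row s = trans (row≈0 s) (sym (trans (+-cong (zeroˡ _) (zeroˡ _)) (+-identityˡ 0#)))

    -- Deleting columns c and j = punchIn c j′ in either order: c′ is the position of c once j is gone.
    punchIn-exchange : ∀ {m} (c : Fin (suc (suc m))) (j′ : Fin (suc m)) →
      Σ[ c′ ∈ Fin (suc m) ]
          punchIn (punchIn c j′) c′ ≡ c
        × (∀ s → punchIn (punchIn c j′) (punchIn c′ s) ≡ punchIn c (punchIn j′ s))
        × sign (toℕ (punchIn c j′)) * sign (toℕ c′) ≈ - (sign (toℕ c) * sign (toℕ j′))
    punchIn-exchange zero j′ = zero , ≡.refl , (λ s → ≡.refl) , (begin
      - sign (toℕ j′) * 1#    ≈⟨ *-identityʳ _ ⟩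
      - sign (toℕ j′)         ≈⟨ -‿cong (*-identityˡ _) ⟨
      - (1# * sign (toℕ j′))  ∎)
    punchIn-exchange (suc c) zero = c , ≡.refl , (λ s → ≡.refl) , (begin
      1# * sign (toℕ c)         ≈⟨ *-identityˡ _ ⟩
      sign (toℕ c)              ≈⟨ -‿involutive _ ⟨
      - - sign (toℕ c)          ≈⟨ -‿cong (*-identityʳ _) ⟨
      - (- sign (toℕ c) * 1#)   ∎)
    punchIn-exchange {suc m} (suc c) (suc j′) with punchIn-exchange c j′
    ... | c′ , hit , commute , signs = suc c′ , ≡.cong suc hit , commute′ , (begin
      - sign (toℕ (punchIn c j′)) * - sign (toℕ c′)   ≈⟨ -x*-y≈x*y _ _ ⟩
      sign (toℕ (punchIn c j′)) * sign (toℕ c′)       ≈⟨ signs ⟩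
      - (sign (toℕ c) * sign (toℕ j′))                ≈⟨ -‿cong (-x*-y≈x*y _ _) ⟨
      - (- sign (toℕ c) * - sign (toℕ j′))            ∎)
      where
      commute′ : ∀ s → punchIn (suc (punchIn c j′)) (punchIn (suc c′) s) ≡ punchIn (suc c) (punchIn (suc j′) s)
      commute′ zero    = ≡.refl
      commute′ (suc s) = ≡.cong suc (commute s)

    det-unitRow : ∀ {n} (M : Matrix (suc n)) i c → M i c ≈ 1# → (∀ s → M i (punchIn c s) ≈ 0#) →
                  det (suc n) M ≈ cofactor M i c
    det-unitRow M zero c one zeros = begin
      det _ M                        ≈⟨ sum-single (λ j → M zero j * cofactor M zero j) c (λ s → trans (*-congʳ (zeros s)) (zeroˡ _)) ⟩
      M zero c * cofactor M zero c   ≈⟨ *-congʳ one ⟩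
      1# * cofactor M zero c         ≈⟨ *-identityˡ _ ⟩
      cofactor M zero c              ∎
    det-unitRow {suc n} M (suc i) c one zeros = begin
      det _ M
        ≈⟨ sum-remove {i = c} (λ j → M zero j * cofactor M zero j) ⟩
      M zero c * cofactor M zero c + sum (λ j′ → M zero (punchIn c j′) * cofactor M zero (punchIn c j′))
        ≈⟨ +-cong deleted≈0 (sum-cong-≋ {suc n} remaining) ⟩
      0# + sum (λ j′ → x * (N zero j′ * cofactor N zero j′))
        ≈⟨ +-identityˡ _ ⟩
      sum (λ j′ → x * (N zero j′ * cofactor N zero j′))
        ≈⟨ *-distribˡ-sum x (λ j′ → N zero j′ * cofactor N zero j′) ⟨
      cofactor M (suc i) c ∎
      where
      N : Matrix (suc n)
      N = minor M (suc i) c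
      x : Carrier
      x = sign (toℕ (suc i)) * sign (toℕ c)

      deleted≈0 : M zero c * cofactor M zero c ≈ 0#
      deleted≈0 = trans (*-congˡ (trans (*-congˡ (det-zeroRow (minor M zero c) i zeros)) (zeroʳ _))) (zeroʳ _)

      rearrange : ∀ m z a w b d → m * (z * a * (w * b * d)) ≈ w * (a * b) * (m * (z * d))
      rearrange = solve 6 (λ m z a w b d → m :* (z :* a :* (w :* b :* d)) := w :* (a :* b) :* (m :* (z :* d))) refl

      moveSign : ∀ w u v m z d → w * - (u * v) * (m * (z * d)) ≈ - w * u * (m * (z * v * d))
      moveSign w u v m z d = begin
        w * - (u * v) * (m * (z * d))     ≈⟨ *-congʳ (-‿distribʳ-* w (u * v)) ⟨
        - (w * (u * v)) * (m * (z * d))   ≈⟨ -‿distribˡ-* _ _ ⟨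
        - (w * (u * v) * (m * (z * d)))   ≈⟨ -‿cong (solve 6 (λ w u v m z d → w :* (u :* v) :* (m :* (z :* d)) := w :* u :* (m :* (z :* v :* d))) refl w u v m z d) ⟩
        - (w * u * (m * (z * v * d)))     ≈⟨ -‿distribˡ-* _ _ ⟩
        - (w * u) * (m * (z * v * d))     ≈⟨ *-congʳ (-‿distribˡ-* w u) ⟩
        - w * u * (m * (z * v * d))       ∎

      -- The minor at column j = punchIn c j′ still has a unit row; expanding it and exchanging the two
      -- deleted columns gives x times the j′-th term of the first-row expansion of N.
      remaining : ∀ j′ → M zero (punchIn c j′) * cofactor M zero (punchIn c j′) ≈ x * (N zero j′ * cofactor N zero j′)
      remaining j′ with punchIn-exchange c j′
      ... | c′ , hit , commute , signs = begin
        M zero j * (sign 0 * sign (toℕ j) * det (suc n) (minor M zero j))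
          ≈⟨ *-congˡ (*-congˡ (det-unitRow (minor M zero j) i c′
               (trans (reflexive (≡.cong (M (suc i)) hit)) one)
               (λ s → trans (reflexive (≡.cong (M (suc i)) (commute s))) (zeros (punchIn j′ s))))) ⟩
        M zero j * (sign 0 * sign (toℕ j) * (sign (toℕ i) * sign (toℕ c′) * det n (minor (minor M zero j) i c′)))
          ≈⟨ *-congˡ (*-congˡ (*-congˡ (det-cong n λ r s → reflexive (≡.cong (M (suc (punchIn i r))) (commute s))))) ⟩
        M zero j * (sign 0 * sign (toℕ j) * (sign (toℕ i) * sign (toℕ c′) * D))
          ≈⟨ rearrange (M zero j) (sign 0) (sign (toℕ j)) (sign (toℕ i)) (sign (toℕ c′)) D ⟩
        sign (toℕ i) * (sign (toℕ j) * sign (toℕ c′)) * (M zero j * (sign 0 * D))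
          ≈⟨ *-congʳ (*-congˡ signs) ⟩
        sign (toℕ i) * - (sign (toℕ c) * sign (toℕ j′)) * (M zero j * (sign 0 * D))
          ≈⟨ moveSign (sign (toℕ i)) (sign (toℕ c)) (sign (toℕ j′)) (M zero j) (sign 0) D ⟩
        x * (M zero j * (sign 0 * sign (toℕ j′) * D)) ∎
        where
        j : Fin (suc (suc n))
        j = punchIn c j′
        D : Carrier
        D = det n (minor N zero j′)

    det-twoEntryRow : ∀ {n} (M : Matrix (suc n)) i c d → c ≢ d → (∀ s → s ≢ c → s ≢ d → M i s ≈ 0#) →
                      det (suc n) M ≈ M i c * cofactor M i c + M i d * cofactor M i d
    det-twoEntryRow {n} M i c d c≢d others = begin
      det _ M
        ≈⟨ det-linearRow i M (withRow c) (withRow d) (M i c) (M i d) (unchanged c) (unchanged d) row ⟩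
      M i c * det _ (withRow c) + M i d * det _ (withRow d)
        ≈⟨ +-cong (*-congˡ (expand c)) (*-congˡ (expand d)) ⟩
      M i c * cofactor M i c + M i d * cofactor M i d ∎
      where
      withRow : Fin (suc n) → Matrix (suc n)
      withRow e = updateAt M i (λ _ → unitVector e)

      rowᵢ : ∀ e s → withRow e i s ≡ unitVector e s
      rowᵢ e s = ≡.cong-app (updateAt-updates i M) s

      unchanged : ∀ e r s → M (punchIn i r) s ≈ withRow e (punchIn i r) s
      unchanged e r s = reflexive (≡.sym (≡.cong-app (updateAt-minimal (punchIn i r) i M (punchInᵢ≢i i r)) s))

      unit-self : ∀ e → withRow e i e ≈ 1#
      unit-self e = reflexive (≡.trans (rowᵢ e e) (updateAt-updates e (λ _ → 0#)))

      unit-≢ : ∀ {e s} → s ≢ e → withRow e i s ≈ 0#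
      unit-≢ {e} {s} s≢e = reflexive (≡.trans (rowᵢ e s) (updateAt-minimal s e (λ _ → 0#) s≢e))

      expand : ∀ e → det (suc n) (withRow e) ≈ cofactor M i e
      expand e = trans (det-unitRow (withRow e) i e (unit-self e) (λ s → unit-≢ (punchInᵢ≢i e s)))
                       (cofactor-cong i e {withRow e} {M} λ r s → sym (unchanged e r s))

      row : ∀ s → M i s ≈ M i c * withRow c i s + M i d * withRow d i s
      row s with s ≟ c | s ≟ d
      ... | yes ≡.refl | _ = sym (begin
        M i s * withRow c i s + M i d * withRow d i s   ≈⟨ +-cong (*-congˡ (unit-self c)) (*-congˡ (unit-≢ c≢d)) ⟩
        M i s * 1# + M i d * 0#                         ≈⟨ +-cong (*-identityʳ _) (zeroʳ _) ⟩
        M i s + 0#                                      ≈⟨ +-identityʳ _ ⟩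
        M i s                                           ∎)
      ... | no s≢c | yes ≡.refl = sym (begin
        M i c * withRow c i s + M i s * withRow d i s   ≈⟨ +-cong (*-congˡ (unit-≢ s≢c)) (*-congˡ (unit-self d)) ⟩
        M i c * 0# + M i s * 1#                         ≈⟨ +-cong (zeroʳ _) (*-identityʳ _) ⟩
        0# + M i s                                      ≈⟨ +-identityˡ _ ⟩
        M i s                                           ∎)
      ... | no s≢c | no s≢d = begin
        M i s                                           ≈⟨ others s s≢c s≢d ⟩
        0#                                              ≈⟨ +-identityˡ 0# ⟨
        0# + 0#                                         ≈⟨ +-cong (zeroʳ _) (zeroʳ _) ⟨
        M i c * 0# + M i d * 0#                         ≈⟨ +-cong (*-congˡ (unit-≢ s≢c)) (*-congˡ (unit-≢ s≢d)) ⟨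
        M i c * withRow c i s + M i d * withRow d i s   ∎

    det-unitFirstColumn : ∀ {n} (M : Matrix (suc n)) → (∀ r → M (suc r) zero ≈ 0#) →
                          det (suc n) M ≈ M zero zero * cofactor M zero zero
    det-unitFirstColumn {zero}  M _   = sum-single (λ j → M zero j * cofactor M zero j) zero λ ()
    det-unitFirstColumn {suc n} M col = sum-single (λ j → M zero j * cofactor M zero j) zero λ s →
      trans (*-congˡ (trans (*-congˡ (det-zeroColumn (minor M zero (suc s)) zero col)) (zeroʳ _))) (zeroʳ _)

    det-pendantFirst : ∀ {n} (M : Matrix (suc (suc n))) →
                       (∀ s → M zero (suc (suc s)) ≈ 0#) → (∀ r → M (suc (suc r)) zero ≈ 0#) →
                       det (suc (suc n)) M
                         ≈ M zero zero * det (suc n) (λ r s → M (suc r) (suc s))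
                           - M zero (suc zero) * (M (suc zero) zero * det n (λ r s → M (suc (suc r)) (suc (suc s))))
    det-pendantFirst {n} M row col = begin
      det _ M
        ≈⟨ det-twoEntryRow M zero zero (suc zero) (λ ()) others ⟩
      M zero zero * (1# * 1# * d₁) + M zero (suc zero) * (1# * - 1# * det (suc n) (minor M zero (suc zero)))
        ≈⟨ +-cong (*-congˡ (trans (*-congʳ (*-identityˡ 1#)) (*-identityˡ d₁)))
                  (*-congˡ (*-cong (*-identityˡ (- 1#)) (det-unitFirstColumn (minor M zero (suc zero)) col))) ⟩
      M zero zero * d₁ + M zero (suc zero) * (- 1# * (M (suc zero) zero * (1# * 1# * d₂)))
        ≈⟨ +-congˡ (*-congˡ (trans (-1*x≈-x _) (-‿cong (*-congˡ (trans (*-congʳ (*-identityˡ 1#)) (*-identityˡ d₂)))))) ⟩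
      M zero zero * d₁ + M zero (suc zero) * - (M (suc zero) zero * d₂)
        ≈⟨ +-congˡ (-‿distribʳ-* _ _) ⟨
      M zero zero * d₁ - M zero (suc zero) * (M (suc zero) zero * d₂) ∎
      where
      d₁ d₂ : Carrier
      d₁ = det (suc n) (λ r s → M (suc r) (suc s))
      d₂ = det n (λ r s → M (suc (suc r)) (suc (suc s)))
      others : ∀ s → s ≢ zero → s ≢ suc zero → M zero s ≈ 0#
      others zero          s≢0 _   = contradiction ≡.refl s≢0
      others (suc zero)    _   s≢1 = contradiction ≡.refl s≢1
      others (suc (suc s)) _   _   = row s

    det-indexed-cong : ∀ n {f g : ℕ → ℕ → Carrier} → (∀ {a b} → a < n → b < n → f a b ≈ g a b) →
                       det n (indexed n f) ≈ det n (indexed n g)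
    det-indexed-cong n f≈g = det-cong n λ r s → f≈g (toℕ<n r) (toℕ<n s)

    cofactor-indexed : ∀ {n} f (i c : Fin (suc n)) →
                       cofactor (indexed (suc n) f) i c ≈ sign (toℕ i) * sign (toℕ c) * det n (indexed n (strike (toℕ i) (toℕ c) f))
    cofactor-indexed {n} f i c = *-congˡ (det-cong n λ r s → reflexive (≡.cong₂ f (toℕ-punchIn i r) (toℕ-punchIn c s)))

    det-indexed-zeroColumn : ∀ n f {c} → c < suc n → (∀ {r} → r < suc n → f r c ≈ 0#) →
                             det (suc n) (indexed (suc n) f) ≈ 0#
    det-indexed-zeroColumn n f c< col≈0 = det-zeroColumn (indexed (suc n) f) (fromℕ< c<) λ r →
      trans (reflexive (≡.cong (f (toℕ r)) (toℕ-fromℕ< c<))) (col≈0 (toℕ<n r))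

    det-indexed-twoEntryRow : ∀ n f {i c d} → i < suc n → c < suc n → d < suc n → c ≢ d →
      (∀ {s} → s < suc n → s ≢ c → s ≢ d → f i s ≈ 0#) →
      det (suc n) (indexed (suc n) f)
        ≈ f i c * (sign i * sign c * det n (indexed n (strike i c f)))
          + f i d * (sign i * sign d * det n (indexed n (strike i d f)))
    det-indexed-twoEntryRow n f {i} {c} {d} i< c< d< c≢d others = begin
      det (suc n) (indexed (suc n) f)
        ≈⟨ det-twoEntryRow (indexed (suc n) f) I C D (λ C≡D → c≢d (toℕ-equal C≡D)) others′ ⟩
      indexed _ f I C * cofactor (indexed _ f) I C + indexed _ f I D * cofactor (indexed _ f) I D
        ≈⟨ +-cong (*-congˡ (cofactor-indexed f I C)) (*-congˡ (cofactor-indexed f I D)) ⟩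
      term (toℕ I) (toℕ C) + term (toℕ I) (toℕ D)
        ≡⟨ ≡.cong₂ _+_ (≡.cong₂ term (toℕ-fromℕ< i<) (toℕ-fromℕ< c<)) (≡.cong₂ term (toℕ-fromℕ< i<) (toℕ-fromℕ< d<)) ⟩
      term i c + term i d ∎
      where
      term : ℕ → ℕ → Carrier
      term i c = f i c * (sign i * sign c * det n (indexed n (strike i c f)))
      I C D : Fin (suc n)
      I = fromℕ< i<
      C = fromℕ< c<
      D = fromℕ< d<
      toℕ-equal : C ≡ D → c ≡ d
      toℕ-equal C≡D = ≡.trans (≡.sym (toℕ-fromℕ< c<)) (≡.trans (≡.cong toℕ C≡D) (toℕ-fromℕ< d<))
      others′ : ∀ s → s ≢ C → s ≢ D → indexed (suc n) f I s ≈ 0#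
      others′ s s≢C s≢D = trans (reflexive (≡.cong (λ i → f i (toℕ s)) (toℕ-fromℕ< i<)))
        (others (toℕ<n s) (λ s≡c → s≢C (toℕ-injective (≡.trans s≡c (≡.sym (toℕ-fromℕ< c<)))))
                          (λ s≡d → s≢D (toℕ-injective (≡.trans s≡d (≡.sym (toℕ-fromℕ< d<))))))

-- Imported only here: these operator names would clash with the ring operations inside Determinant.
open import Defs hiding (det; sign)
open import Algebra.Structures using (IsCommutativeRing)
import Algebra.Solver.Ring.AlmostCommutativeRing as ACR
import Algebra.Solver.Ring.Simple as SimpleSolver
open import Data.Bool using (Bool; true; false; _∧_; _∨_; if_then_else_)
open import Data.Bool.Properties using (∧-identityʳ; ∧-zeroʳ; ∨-identityʳ)
open import Data.Empty using (⊥-elim)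
open import Data.Integer using (ℤ; +_; -_; -[1+_]; 0ℤ; 1ℤ; -1ℤ)
  renaming (_+_ to _+ℤ_; _*_ to _*ℤ_; _-_ to _-ℤ_)
import Data.Integer.Properties as ℤ
open import Data.Integer.Tactic.RingSolver using (solve-∀)
open import Data.List using ([]; _∷_)
open import Data.Maybe using (just)
open import Data.Nat using (_+_; _*_; z≤n; _≡ᵇ_; _<ᵇ_)
open import Data.Nat.Properties
  using (≤-refl; <-trans; n<1+n; n≤1+n; 1+n≢n; <⇒≢; <⇒≤; ≤-pred; ≤∧≢⇒<; m≤n⇒m<n∨m≡n; +-cancelˡ-≡)
import Data.Nat.Tactic.RingSolver as ℕ-Solver
open import Data.Product using (proj₁; proj₂)
open import Data.Product.Properties using (≡-dec)
open import Data.Sum using (inj₁; inj₂)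
open import Data.Unit using (⊤; tt)
open import Function using (_∘_; _∋_)
open import Level using (0ℓ)
open import Relation.Binary.PropositionalEquality using (refl; sym; trans; cong; cong₂; module ≡-Reasoning)

-- Dual numbers: (a , b) stands for a + bε with ε² = 0, i.e. ℤ[λ] modulo λ².
Dual : Set
Dual = ℤ × ℤ

infixl 6 _+ᵈ_ _-ᵈ_
infixl 7 _*ᵈ_
infix  8 -ᵈ_

_+ᵈ_ : Dual → Dual → Dual
(a , b) +ᵈ (c , d) = a +ℤ c , b +ℤ d

_*ᵈ_ : Dual → Dual → Dual
(a , b) *ᵈ (c , d) = a *ℤ c , a *ℤ d +ℤ b *ℤ c

-ᵈ_ : Dual → Dual
-ᵈ (a , b) = - a , - b

_-ᵈ_ : Dual → Dual → Dual
x -ᵈ y = x +ᵈ -ᵈ y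

0ᵈ 1ᵈ ε : Dual
0ᵈ = 0ℤ , 0ℤ
1ᵈ = 1ℤ , 0ℤ
ε  = 0ℤ , 1ℤ

ι : ℤ → Dual
ι a = a , 0ℤ

private
  *-assoc-εcoeff : ∀ a b c d e f → a *ℤ c *ℤ f +ℤ (a *ℤ d +ℤ b *ℤ c) *ℤ e ≡ a *ℤ (c *ℤ f +ℤ d *ℤ e) +ℤ b *ℤ (c *ℤ e)
  *-assoc-εcoeff = solve-∀
  *-identityˡ-εcoeff : ∀ a b → 1ℤ *ℤ b +ℤ 0ℤ *ℤ a ≡ b
  *-identityˡ-εcoeff = solve-∀
  *-identityʳ-εcoeff : ∀ a b → a *ℤ 0ℤ +ℤ b *ℤ 1ℤ ≡ b
  *-identityʳ-εcoeff = solve-∀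
  distribˡ-εcoeff : ∀ a b c d e f → a *ℤ (d +ℤ f) +ℤ b *ℤ (c +ℤ e) ≡ a *ℤ d +ℤ b *ℤ c +ℤ (a *ℤ f +ℤ b *ℤ e)
  distribˡ-εcoeff = solve-∀
  distribʳ-εcoeff : ∀ a b c d e f → (c +ℤ e) *ℤ b +ℤ (d +ℤ f) *ℤ a ≡ c *ℤ b +ℤ d *ℤ a +ℤ (e *ℤ b +ℤ f *ℤ a)
  distribʳ-εcoeff = solve-∀
  *-comm-εcoeff : ∀ a b c d → a *ℤ d +ℤ b *ℤ c ≡ c *ℤ b +ℤ d *ℤ a
  *-comm-εcoeff = solve-∀

dual-isCommutativeRing : IsCommutativeRing _≡_ _+ᵈ_ _*ᵈ_ (-ᵈ_) 0ᵈ 1ᵈ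
dual-isCommutativeRing = record
  { isRing = record
    { +-isAbelianGroup = record
      { isGroup = record
        { isMonoid = record
          { isSemigroup = record
            { isMagma = record { isEquivalence = ≡.isEquivalence ; ∙-cong = cong₂ _+ᵈ_ }
            ; assoc = λ { (a , b) (c , d) (e , f) → cong₂ _,_ (ℤ.+-assoc a c e) (ℤ.+-assoc b d f) } }
          ; identity = (λ { (a , b) → cong₂ _,_ (ℤ.+-identityˡ a) (ℤ.+-identityˡ b) })
                     , (λ { (a , b) → cong₂ _,_ (ℤ.+-identityʳ a) (ℤ.+-identityʳ b) }) }
        ; inverse = (λ { (a , b) → cong₂ _,_ (ℤ.+-inverseˡ a) (ℤ.+-inverseˡ b) })
                  , (λ { (a , b) → cong₂ _,_ (ℤ.+-inverseʳ a) (ℤ.+-inverseʳ b) })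
        ; ⁻¹-cong = cong (-ᵈ_) }
      ; comm = λ { (a , b) (c , d) → cong₂ _,_ (ℤ.+-comm a c) (ℤ.+-comm b d) } }
    ; *-cong = cong₂ _*ᵈ_
    ; *-assoc = λ { (a , b) (c , d) (e , f) → cong₂ _,_ (ℤ.*-assoc a c e) (*-assoc-εcoeff a b c d e f) }
    ; *-identity = (λ { (a , b) → cong₂ _,_ (ℤ.*-identityˡ a) (*-identityˡ-εcoeff a b) })
                 , (λ { (a , b) → cong₂ _,_ (ℤ.*-identityʳ a) (*-identityʳ-εcoeff a b) })
    ; distrib = (λ { (a , b) (c , d) (e , f) → cong₂ _,_ (ℤ.*-distribˡ-+ a c e) (distribˡ-εcoeff a b c d e f) })
              , (λ { (a , b) (c , d) (e , f) → cong₂ _,_ (ℤ.*-distribʳ-+ a c e) (distribʳ-εcoeff a b c d e f) }) }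
  ; *-comm = λ { (a , b) (c , d) → cong₂ _,_ (ℤ.*-comm a c) (*-comm-εcoeff a b c d) } }

dualRing : CommutativeRing 0ℓ 0ℓ
dualRing = record { isCommutativeRing = dual-isCommutativeRing }

open Determinant dualRing
open CommutativeRing dualRing using (+-identityˡ; +-identityʳ; zeroˡ; zeroʳ; *-identityˡ; semiring)
open import Algebra.Properties.Semiring.Sum semiring using (sum)
open SimpleSolver (ACR.fromCommutativeRing dualRing) (≡-dec ℤ._≟_ ℤ._≟_) using (solve; _:+_; _:*_; :-_; _:=_; con)

coeff₀ coeff₁ : Poly → ℤ
coeff₀ []      = 0ℤ
coeff₀ (a ∷ _) = a
coeff₁ []      = 0ℤ
coeff₁ (_ ∷ p) = coeff₀ p

truncate : Poly → Dual
truncate p = coeff₀ p , coeff₁ p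

coeff₀-⊕ : ∀ p q → coeff₀ (p ⊕ q) ≡ coeff₀ p +ℤ coeff₀ q
coeff₀-⊕ []      q       = sym (ℤ.+-identityˡ (coeff₀ q))
coeff₀-⊕ (a ∷ p) []      = sym (ℤ.+-identityʳ a)
coeff₀-⊕ (a ∷ p) (b ∷ q) = refl

truncate-⊕ : ∀ p q → truncate (p ⊕ q) ≡ truncate p +ᵈ truncate q
truncate-⊕ []      q       = sym (+-identityˡ (truncate q))
truncate-⊕ (a ∷ p) []      = sym (+-identityʳ (truncate (a ∷ p)))
truncate-⊕ (a ∷ p) (b ∷ q) = cong (a +ℤ b ,_) (coeff₀-⊕ p q)

coeff₀-scale : ∀ c p → coeff₀ (scale c p) ≡ c *ℤ coeff₀ p
coeff₀-scale c []      = sym (ℤ.*-zeroʳ c)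
coeff₀-scale c (a ∷ p) = refl

truncate-scale : ∀ c p → truncate (scale c p) ≡ ι c *ᵈ truncate p
truncate-scale c []      = sym (zeroʳ (ι c))
truncate-scale c (a ∷ p) = cong (c *ℤ a ,_) (trans (coeff₀-scale c p) (+0*a c (coeff₀ p) a))
  where
  +0*a : ∀ c b a → c *ℤ b ≡ c *ℤ b +ℤ 0ℤ *ℤ a
  +0*a = solve-∀

coeff₀-⊗ : ∀ p q → coeff₀ (p ⊗ q) ≡ coeff₀ p *ℤ coeff₀ q
coeff₀-⊗ []      q = refl
coeff₀-⊗ (a ∷ p) q = begin
  coeff₀ (scale a q ⊕ (0ℤ ∷ p ⊗ q))   ≡⟨ coeff₀-⊕ (scale a q) (0ℤ ∷ p ⊗ q) ⟩
  coeff₀ (scale a q) +ℤ 0ℤ            ≡⟨ ℤ.+-identityʳ _ ⟩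
  coeff₀ (scale a q)                  ≡⟨ coeff₀-scale a q ⟩
  a *ℤ coeff₀ q                       ∎
  where open ≡-Reasoning

truncate-⊗ : ∀ p q → truncate (p ⊗ q) ≡ truncate p *ᵈ truncate q
truncate-⊗ []      q = sym (zeroˡ (truncate q))
truncate-⊗ (a ∷ p) q = begin
  truncate (scale a q ⊕ (0ℤ ∷ p ⊗ q))                 ≡⟨ truncate-⊕ (scale a q) (0ℤ ∷ p ⊗ q) ⟩
  truncate (scale a q) +ᵈ (0ℤ , coeff₀ (p ⊗ q))       ≡⟨ cong₂ _+ᵈ_ (truncate-scale a q) (cong (0ℤ ,_) (coeff₀-⊗ p q)) ⟩
  ι a *ᵈ truncate q +ᵈ (0ℤ , coeff₀ p *ℤ coeff₀ q)    ≡⟨ ι*+ε* a (coeff₀ p) (truncate q) ⟩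
  truncate (a ∷ p) *ᵈ truncate q                      ∎
  where
  open ≡-Reasoning
  ι*+ε* : ∀ a b x → ι a *ᵈ x +ᵈ (0ℤ , b *ℤ proj₁ x) ≡ (a , b) *ᵈ x
  ι*+ε* a b (c , d) = cong₂ _,_ (first a c) (second a b c d)
    where
    first : ∀ a c → a *ℤ c +ℤ 0ℤ ≡ a *ℤ c
    first = solve-∀
    second : ∀ a b c d → a *ℤ d +ℤ 0ℤ *ℤ c +ℤ b *ℤ c ≡ a *ℤ d +ℤ b *ℤ c
    second = solve-∀

ι-sign : ∀ k → ι (Defs.sign k) ≡ sign k
ι-sign zero    = refl
ι-sign (suc k) = cong (-ᵈ_) (ι-sign k)

PolyMatrix : ℕ → Set
PolyMatrix n = Fin n → Fin n → Poly

laplaceTerm : ∀ {n} → PolyMatrix (suc n) → Fin (suc n) → Poly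
laplaceTerm {n} M j = scale (Defs.sign (toℕ j)) (M zero j ⊗ Defs.det n (λ r c → M (suc r) (punchIn j c)))

-- Defs.det sums its Laplace terms with a local helper `go`, which cannot be named.  laplaceSum is that
-- helper, recovered by unification: unfold₂ exposes `go` after two steps and capture abstracts its
-- arguments to variables, so that match solves laplaceSum = go.
mutual
  laplaceSum : (n : ℕ) → PolyMatrix (suc n) → (k : ℕ) → (Fin k → Fin (suc n)) → Poly
  laplaceSum = _

  private
    tail₂ : (m : ℕ) → PolyMatrix (suc (suc m)) → Poly
    tail₂ = _

    unfold₂ : ∀ m M → Defs.det (suc (suc m)) M ≡ laplaceTerm M zero ⊕ (laplaceTerm M (suc zero) ⊕ tail₂ m M)
    unfold₂ m M = refl

    match : (n : ℕ) (M : PolyMatrix (suc n)) (k : ℕ) (f : Fin k → Fin (suc n)) (p : Poly) →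
            p ≡ laplaceSum n M k f → ⊤
    match _ _ _ _ _ _ = tt

    capture : (m : ℕ) (M : PolyMatrix (suc (suc m))) (p : Poly) → p ≡ tail₂ m M → ⊤
    capture m with suc m | (Fin m → Fin (suc (suc m))) ∋ (λ i → suc (suc i))
    ... | N | f = λ M p eq → match N M m f p eq

mutual
  truncate-det : ∀ n (M : PolyMatrix n) → truncate (Defs.det n M) ≡ det n (λ i j → truncate (M i j))
  truncate-det zero    M = sym (det-empty _)
  truncate-det (suc n) M = trans (truncate-laplaceSum n M (suc n) (λ j → j)) (sym (det-expand _))

  truncate-laplaceSum : ∀ n (M : PolyMatrix (suc n)) k (f : Fin k → Fin (suc n)) →
    truncate (laplaceSum n M k f) ≡ sum λ i → truncate (M zero (f i)) *ᵈ cofactor (λ r c → truncate (M r c)) zero (f i)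
  truncate-laplaceSum n M zero    f = refl
  truncate-laplaceSum n M (suc k) f = begin
    truncate (laplaceTerm M j ⊕ laplaceSum n M k (λ i → f (suc i)))
      ≡⟨ truncate-⊕ (laplaceTerm M j) _ ⟩
    truncate (laplaceTerm M j) +ᵈ truncate (laplaceSum n M k (λ i → f (suc i)))
      ≡⟨ cong₂ _+ᵈ_ term (truncate-laplaceSum n M k (λ i → f (suc i))) ⟩
    N zero j *ᵈ cofactor N zero j +ᵈ sum (λ i → N zero (f (suc i)) *ᵈ cofactor N zero (f (suc i))) ∎
    where
    open ≡-Reasoning
    j : Fin (suc n)
    j = f zero
    N : Matrix (suc n)
    N r c = truncate (M r c)
    P : PolyMatrix n
    P r c = M (suc r) (punchIn j c)
    term : truncate (laplaceTerm M j) ≡ N zero j *ᵈ cofactor N zero j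
    term = begin
      truncate (scale (Defs.sign (toℕ j)) (M zero j ⊗ Defs.det n P))
        ≡⟨ truncate-scale (Defs.sign (toℕ j)) (M zero j ⊗ Defs.det n P) ⟩
      ι (Defs.sign (toℕ j)) *ᵈ truncate (M zero j ⊗ Defs.det n P)
        ≡⟨ cong₂ _*ᵈ_ (ι-sign (toℕ j)) (trans (truncate-⊗ (M zero j) (Defs.det n P)) (cong (N zero j *ᵈ_) (truncate-det n P))) ⟩
      sign (toℕ j) *ᵈ (N zero j *ᵈ det n (minor N zero j))
        ≡⟨ solve 3 (λ s x d → s :* (x :* d) := x :* (con 1ᵈ :* s :* d)) refl (sign (toℕ j)) (N zero j) (det n (minor N zero j)) ⟩
      N zero j *ᵈ cofactor N zero j ∎

χ : Bool → Dual
χ true  = 1ᵈ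
χ false = 0ᵈ

weight : Bool → Bool → Dual
weight diagonal adjacent = ε *ᵈ χ diagonal -ᵈ χ adjacent

truncate-weight : ∀ d a → truncate ((if d then X else []) ⊕ (if a then const (- 1ℤ) else [])) ≡ weight d a
truncate-weight false false = refl
truncate-weight false true  = refl
truncate-weight true  false = refl
truncate-weight true  true  = refl

truncate-charPoly : ∀ n A → truncate (charPoly n A) ≡ det n (λ i j → weight (i ≟ᶠ j) (A i j))
truncate-charPoly n A = trans (truncate-det n _) (det-cong n λ i j → truncate-weight (i ≟ᶠ j) (A i j))

ε-shift : ∀ a b c d → ε *ᵈ (a , b) -ᵈ (c , d) ≡ (- c , a -ℤ d)
ε-shift a b c d = cong₂ _,_ (first a c) (second a b d)
  where
  first : ∀ a c → 0ℤ *ℤ a +ℤ - c ≡ - c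
  first = solve-∀
  second : ∀ a b d → 0ℤ *ℤ b +ℤ 1ℤ *ℤ a +ℤ - d ≡ a -ℤ d
  second = solve-∀

pathEntry : ℕ → ℕ → Dual
pathEntry a b = weight (a ≡ᵇ b) ((suc a ≡ᵇ b) ∨ (suc b ≡ᵇ a))

pathDet : ℕ → Dual
pathDet k = det k (indexed k pathEntry)

pathDet-zero : pathDet 0 ≡ 1ᵈ
pathDet-zero = det-empty _

pathDet-one : pathDet 1 ≡ ε
pathDet-one = trans (det-unitFirstColumn (indexed 1 pathEntry) (λ ()))
                    (cong (λ d → ε *ᵈ (1ᵈ *ᵈ 1ᵈ *ᵈ d)) (det-empty _))

pathDet-recurrence : ∀ k → pathDet (2 + k) ≡ ε *ᵈ pathDet (1 + k) -ᵈ pathDet k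
pathDet-recurrence k = begin
  pathDet (2 + k)
    ≡⟨ det-pendantFirst (indexed (2 + k) pathEntry) (λ _ → refl) (λ _ → refl) ⟩
  ε *ᵈ pathDet (1 + k) -ᵈ -ᵈ 1ᵈ *ᵈ (-ᵈ 1ᵈ *ᵈ pathDet k)
    ≡⟨ solve 2 (λ p q → con ε :* p :+ :- (con (-ᵈ 1ᵈ) :* (con (-ᵈ 1ᵈ) :* q)) := con ε :* p :+ :- q)
             refl (pathDet (1 + k)) (pathDet k) ⟩
  ε *ᵈ pathDet (1 + k) -ᵈ pathDet k ∎
  where open ≡-Reasoning

pathDet-step : ∀ k {a b c d} → pathDet (1 + k) ≡ (a , b) → pathDet k ≡ (c , d) → pathDet (2 + k) ≡ (- c , a -ℤ d)
pathDet-step k {a} {b} {c} {d} P₁₊ₖ Pₖ =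
  trans (pathDet-recurrence k) (trans (cong₂ (λ x y → ε *ᵈ x -ᵈ y) P₁₊ₖ Pₖ) (ε-shift a b c d))

odd-after-even : ∀ t → 1ℤ -ℤ - (+ (2 * (t + 1))) ≡ + (2 * suc t + 1)
odd-after-even t = trans (cong (1ℤ +ℤ_) (ℤ.neg-involutive (+ (2 * (t + 1))))) (cong +_ (arith t))
  where
  arith : ∀ t → 1 + 2 * (t + 1) ≡ 2 * suc t + 1
  arith = ℕ-Solver.solve-∀

even-after-odd : ∀ t → -1ℤ -ℤ + (2 * t + 1) ≡ - (+ (2 * (t + 1)))
even-after-odd t = trans (negate (+ (2 * t + 1))) (cong (λ k → - (+ k)) (arith t))
  where
  negate : ∀ x → -1ℤ -ℤ x ≡ - (1ℤ +ℤ x)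
  negate = solve-∀
  arith : ∀ t → 1 + (2 * t + 1) ≡ 2 * (t + 1)
  arith = ℕ-Solver.solve-∀

pathDet-periodic : ∀ t → pathDet (t * 4) ≡ (1ℤ , 0ℤ)
                       × pathDet (1 + t * 4) ≡ (0ℤ , + (2 * t + 1))
                       × pathDet (2 + t * 4) ≡ (-1ℤ , 0ℤ)
                       × pathDet (3 + t * 4) ≡ (0ℤ , - (+ (2 * (t + 1))))
pathDet-periodic zero = pathDet-zero , pathDet-one , P₂ , pathDet-step 1 P₂ pathDet-one
  where
  P₂ : pathDet 2 ≡ (-1ℤ , 0ℤ)
  P₂ = pathDet-step 0 pathDet-one pathDet-zero
pathDet-periodic (suc t) with pathDet-periodic t
... | _ , _ , P₂ , P₃ = P₄ , P₅ , P₆ , P₇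
  where
  P₄ : pathDet (4 + t * 4) ≡ (1ℤ , 0ℤ)
  P₄ = pathDet-step (2 + t * 4) P₃ P₂
  P₅ : pathDet (5 + t * 4) ≡ (0ℤ , + (2 * suc t + 1))
  P₅ = trans (pathDet-step (3 + t * 4) P₄ P₃) (cong (0ℤ ,_) (odd-after-even t))
  P₆ : pathDet (6 + t * 4) ≡ (-1ℤ , 0ℤ)
  P₆ = pathDet-step (4 + t * 4) P₅ P₄
  P₇ : pathDet (7 + t * 4) ≡ (0ℤ , - (+ (2 * (suc t + 1))))
  P₇ = trans (pathDet-step (5 + t * 4) P₆ P₅) (cong (0ℤ ,_) (even-after-odd (suc t)))

≡ᵇ-refl : ∀ a → (a ≡ᵇ a) ≡ true
≡ᵇ-refl zero    = refl
≡ᵇ-refl (suc a) = ≡ᵇ-refl a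

≢⇒≡ᵇ-false : ∀ {a b} → a ≢ b → (a ≡ᵇ b) ≡ false
≢⇒≡ᵇ-false {zero}  {zero}  a≢b = ⊥-elim (a≢b refl)
≢⇒≡ᵇ-false {zero}  {suc b} _   = refl
≢⇒≡ᵇ-false {suc a} {zero}  _   = refl
≢⇒≡ᵇ-false {suc a} {suc b} a≢b = ≢⇒≡ᵇ-false (a≢b ∘ cong suc)

<⇒<ᵇ-true : ∀ {a b} → a < b → (a <ᵇ b) ≡ true
<⇒<ᵇ-true {zero}  (s≤s _)   = refl
<⇒<ᵇ-true {suc a} (s≤s a<b) = <⇒<ᵇ-true a<b

≤⇒<ᵇ-false : ∀ {a b} → b ≤ a → (a <ᵇ b) ≡ false
≤⇒<ᵇ-false z≤n       = refl
≤⇒<ᵇ-false (s≤s b≤a) = ≤⇒<ᵇ-false b≤a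

suc≡ᵇ∧<ᵇ : ∀ a s → ((suc a ≡ᵇ s) ∧ (s <ᵇ a)) ≡ false
suc≡ᵇ∧<ᵇ a       zero    = refl
suc≡ᵇ∧<ᵇ zero    (suc s) = ∧-zeroʳ (zero ≡ᵇ s)
suc≡ᵇ∧<ᵇ (suc a) (suc s) = suc≡ᵇ∧<ᵇ a s

<suc∧≢⇒< : ∀ {s k} → s < suc k → s ≢ k → s < k
<suc∧≢⇒< s<1+k s≢k = ≤∧≢⇒< (≤-pred s<1+k) s≢k

module Adjacency (m : ℕ) where
  n K L : ℕ
  n = 6 + m
  K = 4 + m
  L = 5 + m

  K<L : K < L
  K<L = n<1+n K

  <K⇒<L : ∀ {s} → s < K → s < L
  <K⇒<L s<K = <-trans s<K K<L

  edge-path : ∀ {a b} → a < K → b < K → edgeT n a b ≡ (suc a ≡ᵇ b)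
  edge-path {a} {b} a<K b<K
    rewrite <⇒<ᵇ-true b<K | ≢⇒≡ᵇ-false (<⇒≢ b<K) | ≢⇒≡ᵇ-false (<⇒≢ a<K)
          | ∧-identityʳ (suc a ≡ᵇ b) | ∧-zeroʳ (a ≡ᵇ 2) = ∨-identityʳ _

  edge-from-L : ∀ {s} → s ≤ L → edgeT n L s ≡ false
  edge-from-L {s} s≤L rewrite ≢⇒≡ᵇ-false {suc L} {s} (<⇒≢ (s≤s s≤L) ∘ sym) | ≢⇒≡ᵇ-false (1+n≢n {m}) = refl

  edge-to-L : ∀ s → edgeT n s L ≡ (s ≡ᵇ K)
  edge-to-L s rewrite ≤⇒<ᵇ-false (n≤1+n m) | ≢⇒≡ᵇ-false (1+n≢n {m}) | ≡ᵇ-refl m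
                    | ∧-zeroʳ (suc s ≡ᵇ L) | ∧-zeroʳ (s ≡ᵇ 2) | ∧-identityʳ (s ≡ᵇ K) = refl

  edge-from-K : ∀ s → edgeT n K s ≡ (s ≡ᵇ L)
  edge-from-K s rewrite suc≡ᵇ∧<ᵇ K s | ≡ᵇ-refl m = refl

  edge-to-K : ∀ s → edgeT n s K ≡ (s ≡ᵇ 2)
  edge-to-K s rewrite ≤⇒<ᵇ-false (≤-refl {m}) | ≡ᵇ-refl m | ≢⇒≡ᵇ-false (1+n≢n {m} ∘ sym)
                    | ∧-zeroʳ (suc s ≡ᵇ K) | ∧-identityʳ (s ≡ᵇ 2) | ∧-zeroʳ (s ≡ᵇ K) = ∨-identityʳ _

  adj : ℕ → ℕ → Bool
  adj a b = edgeT n a b ∨ edgeT n b a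

  adj-path : ∀ {a b} → a < K → b < K → adj a b ≡ ((suc a ≡ᵇ b) ∨ (suc b ≡ᵇ a))
  adj-path a<K b<K = cong₂ _∨_ (edge-path a<K b<K) (edge-path b<K a<K)

  adj-L : ∀ {s} → s ≤ L → adj L s ≡ (s ≡ᵇ K)
  adj-L {s} s≤L = cong₂ _∨_ (edge-from-L s≤L) (edge-to-L s)

  adj-toL : ∀ {s} → s ≤ L → adj s L ≡ (s ≡ᵇ K)
  adj-toL {s} s≤L = trans (cong₂ _∨_ (edge-to-L s) (edge-from-L s≤L)) (∨-identityʳ _)

  adj-K : ∀ s → adj K s ≡ ((s ≡ᵇ L) ∨ (s ≡ᵇ 2))
  adj-K s = cong₂ _∨_ (edge-from-K s) (edge-to-K s)

  adj-toK : ∀ s → adj s K ≡ ((s ≡ᵇ 2) ∨ (s ≡ᵇ L))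
  adj-toK s = cong₂ _∨_ (edge-to-K s) (edge-from-K s)

  entry : ℕ → ℕ → Dual
  entry a b = weight (a ≡ᵇ b) (adj a b)

  entry-path : ∀ {a b} → a < K → b < K → entry a b ≡ pathEntry a b
  entry-path {a} {b} a<K b<K = cong (weight (a ≡ᵇ b)) (adj-path a<K b<K)

  entry-L-L : entry L L ≡ ε
  entry-L-L = cong₂ weight (≡ᵇ-refl L) (trans (adj-L ≤-refl) (≢⇒≡ᵇ-false (<⇒≢ K<L ∘ sym)))

  entry-L-K : entry L K ≡ -ᵈ 1ᵈ
  entry-L-K = cong₂ weight (≢⇒≡ᵇ-false (<⇒≢ K<L ∘ sym)) (trans (adj-L (<⇒≤ K<L)) (≡ᵇ-refl K))

  entry-L-path : ∀ {s} → s < K → entry L s ≡ 0ᵈ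
  entry-L-path s<K = cong₂ weight (≢⇒≡ᵇ-false (<⇒≢ (<K⇒<L s<K) ∘ sym))
    (trans (adj-L (<⇒≤ (<K⇒<L s<K))) (≢⇒≡ᵇ-false (<⇒≢ s<K)))

  entry-path-L : ∀ {s} → s < K → entry s L ≡ 0ᵈ
  entry-path-L s<K = cong₂ weight (≢⇒≡ᵇ-false (<⇒≢ (<K⇒<L s<K)))
    (trans (adj-toL (<⇒≤ (<K⇒<L s<K))) (≢⇒≡ᵇ-false (<⇒≢ s<K)))

  entry-K-K : entry K K ≡ ε
  entry-K-K = cong₂ weight (≡ᵇ-refl K) (trans (adj-K K) (cong₂ _∨_ (≢⇒≡ᵇ-false (<⇒≢ K<L)) refl))

  entry-K-L : entry K L ≡ -ᵈ 1ᵈ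
  entry-K-L = cong₂ weight (≢⇒≡ᵇ-false (<⇒≢ K<L)) (trans (adj-K L) (cong (_∨ (L ≡ᵇ 2)) (≡ᵇ-refl L)))

  entry-K-2 : entry K 2 ≡ -ᵈ 1ᵈ
  entry-K-2 = cong (weight (K ≡ᵇ 2)) (adj-K 2)

  entry-2-K : entry 2 K ≡ -ᵈ 1ᵈ
  entry-2-K = cong (weight (2 ≡ᵇ K)) (adj-toK 2)

  entry-K-path : ∀ {s} → s < K → s ≢ 2 → entry K s ≡ 0ᵈ
  entry-K-path {s} s<K s≢2 = cong₂ weight (≢⇒≡ᵇ-false (<⇒≢ s<K ∘ sym))
    (trans (adj-K s) (cong₂ _∨_ (≢⇒≡ᵇ-false (<⇒≢ (<K⇒<L s<K))) (≢⇒≡ᵇ-false s≢2)))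

  entry-path-K : ∀ {s} → s < K → s ≢ 2 → entry s K ≡ 0ᵈ
  entry-path-K {s} s<K s≢2 = cong₂ weight (≢⇒≡ᵇ-false (<⇒≢ s<K))
    (trans (adj-toK s) (cong₂ _∨_ (≢⇒≡ᵇ-false s≢2) (≢⇒≡ᵇ-false (<⇒≢ (<K⇒<L s<K)))))

module TreeDeterminant (m : ℕ) where
  open Adjacency m

  -- W: row L and column K deleted.  Xₘ: row K and column 2 deleted from the matrix on 0 … K.
  -- X₂: Xₘ without the rows and columns of the leaves 0 and 1, i.e. rows 2 … K−1 and columns 3 … K.
  W Xₘ X₂ : ℕ → ℕ → Dual
  W = strike L K entry
  Xₘ = strike K 2 entry
  X₂ a b = entry (skip K (2 + a)) (3 + b)

  det-W : det (5 + m) (indexed (5 + m) W) ≡ -ᵈ pathDet K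
  det-W = begin
    det (5 + m) (indexed (5 + m) W)
      ≡⟨ det-indexed-twoEntryRow (4 + m) W K<L (s≤s (s≤s (s≤s z≤n))) K<L (λ ()) others ⟩
    W K 2 *ᵈ (sign K *ᵈ sign 2 *ᵈ det (4 + m) (indexed (4 + m) (strike K 2 W)))
      +ᵈ W K K *ᵈ (sign K *ᵈ sign K *ᵈ det (4 + m) (indexed (4 + m) (strike K K W)))
      ≡⟨ cong₂ _+ᵈ_ (cong₂ (λ x y → x *ᵈ (sign K *ᵈ sign 2 *ᵈ y)) W-K-2 deleted≈0)
                    (cong₂ (λ x y → x *ᵈ (sign K *ᵈ sign K *ᵈ y)) W-K-K remaining≈path) ⟩
    -ᵈ 1ᵈ *ᵈ (sign K *ᵈ sign 2 *ᵈ 0ᵈ) +ᵈ -ᵈ 1ᵈ *ᵈ (sign K *ᵈ sign K *ᵈ pathDet K)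
      ≡⟨ cong (λ t → -ᵈ 1ᵈ *ᵈ (sign K *ᵈ sign 2 *ᵈ 0ᵈ) +ᵈ -ᵈ 1ᵈ *ᵈ (t *ᵈ pathDet K)) (sign-square K) ⟩
    -ᵈ 1ᵈ *ᵈ (sign K *ᵈ sign 2 *ᵈ 0ᵈ) +ᵈ -ᵈ 1ᵈ *ᵈ (1ᵈ *ᵈ pathDet K)
      ≡⟨ solve 2 (λ s p → con (-ᵈ 1ᵈ) :* (s :* con 0ᵈ) :+ con (-ᵈ 1ᵈ) :* (con 1ᵈ :* p) := :- p)
               refl (sign K *ᵈ sign 2) (pathDet K) ⟩
    -ᵈ pathDet K ∎
    where
    open ≡-Reasoning
    others : ∀ {s} → s < 5 + m → s ≢ 2 → s ≢ K → W K s ≡ 0ᵈ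
    others s<L s≢2 s≢K = trans (cong₂ entry (skip-< K<L) (skip-< (<suc∧≢⇒< s<L s≢K)))
                               (entry-K-path (<suc∧≢⇒< s<L s≢K) s≢2)
    W-K-2 : W K 2 ≡ -ᵈ 1ᵈ
    W-K-2 = trans (cong (λ a → entry a 2) (skip-< K<L)) entry-K-2
    W-K-K : W K K ≡ -ᵈ 1ᵈ
    W-K-K = trans (cong₂ entry (skip-< K<L) (skip-≥ (≤-refl {K}))) entry-K-L
    deleted≈0 : det (4 + m) (indexed (4 + m) (strike K 2 W)) ≡ 0ᵈ
    deleted≈0 = det-indexed-zeroColumn (3 + m) (strike K 2 W) (n<1+n (3 + m)) λ r<K →
      trans (cong₂ entry (trans (cong (skip L) (skip-< r<K)) (skip-< (<K⇒<L r<K))) (skip-≥ (≤-refl {K})))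
            (entry-path-L r<K)
    remaining≈path : det (4 + m) (indexed (4 + m) (strike K K W)) ≡ pathDet K
    remaining≈path = det-indexed-cong (4 + m) λ a<K b<K →
      trans (cong₂ entry (trans (cong (skip L) (skip-< a<K)) (skip-< (<K⇒<L a<K)))
                         (trans (cong (skip K) (skip-< b<K)) (skip-< b<K)))
            (entry-path a<K b<K)

  det-charMatrix : det (6 + m) (indexed (6 + m) entry) ≡ ε *ᵈ det (5 + m) (indexed (5 + m) entry) -ᵈ pathDet K
  det-charMatrix = begin
    det (6 + m) (indexed (6 + m) entry)
      ≡⟨ det-indexed-twoEntryRow (5 + m) entry (n<1+n L) (n<1+n L) (<-trans K<L (n<1+n L)) (<⇒≢ K<L ∘ sym) others ⟩
    entry L L *ᵈ (sign L *ᵈ sign L *ᵈ det (5 + m) (indexed (5 + m) (strike L L entry)))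
      +ᵈ entry L K *ᵈ (sign L *ᵈ sign K *ᵈ det (5 + m) (indexed (5 + m) W))
      ≡⟨ cong₂ _+ᵈ_ (cong₂ _*ᵈ_ entry-L-L (cong₂ _*ᵈ_ (sign-square L) kept≈rest))
                    (cong₂ (λ x y → x *ᵈ (sign L *ᵈ sign K *ᵈ y)) entry-L-K det-W) ⟩
    ε *ᵈ (1ᵈ *ᵈ A′) +ᵈ -ᵈ 1ᵈ *ᵈ (-ᵈ sign K *ᵈ sign K *ᵈ -ᵈ pathDet K)
      ≡⟨ solve 3 (λ a s p → con ε :* (con 1ᵈ :* a) :+ con (-ᵈ 1ᵈ) :* (:- s :* s :* :- p) := con ε :* a :+ :- (s :* s :* p))
               refl A′ (sign K) (pathDet K) ⟩
    ε *ᵈ A′ -ᵈ sign K *ᵈ sign K *ᵈ pathDet K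
      ≡⟨ cong (λ t → ε *ᵈ A′ -ᵈ t) (trans (cong (_*ᵈ pathDet K) (sign-square K)) (*-identityˡ (pathDet K))) ⟩
    ε *ᵈ A′ -ᵈ pathDet K ∎
    where
    open ≡-Reasoning
    A′ : Dual
    A′ = det (5 + m) (indexed (5 + m) entry)
    others : ∀ {s} → s < 6 + m → s ≢ L → s ≢ K → entry L s ≡ 0ᵈ
    others s<n s≢L s≢K = entry-L-path (<suc∧≢⇒< (<suc∧≢⇒< s<n s≢L) s≢K)
    kept≈rest : det (5 + m) (indexed (5 + m) (strike L L entry)) ≡ A′
    kept≈rest = det-indexed-cong (5 + m) λ a<L b<L → cong₂ entry (skip-< a<L) (skip-< b<L)

  det-X₂ : det (2 + m) (indexed (2 + m) X₂) ≡ -ᵈ (sign (1 + m) *ᵈ pathDet (1 + m))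
  det-X₂ = begin
    det (2 + m) (indexed (2 + m) X₂)
      ≡⟨ det-indexed-twoEntryRow (1 + m) X₂ (s≤s z≤n) (s≤s z≤n) (n<1+n (1 + m)) (λ ()) others ⟩
    X₂ 0 0 *ᵈ (sign 0 *ᵈ sign 0 *ᵈ det (1 + m) (indexed (1 + m) (strike 0 0 X₂)))
      +ᵈ X₂ 0 (1 + m) *ᵈ (sign 0 *ᵈ sign (1 + m) *ᵈ det (1 + m) (indexed (1 + m) (strike 0 (1 + m) X₂)))
      ≡⟨ cong₂ _+ᵈ_ (cong (λ y → X₂ 0 0 *ᵈ (sign 0 *ᵈ sign 0 *ᵈ y)) deleted≈0)
                    (cong₂ (λ x y → x *ᵈ (sign 0 *ᵈ sign (1 + m) *ᵈ y)) entry-2-K remaining≈path) ⟩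
    X₂ 0 0 *ᵈ (1ᵈ *ᵈ 1ᵈ *ᵈ 0ᵈ) +ᵈ -ᵈ 1ᵈ *ᵈ (1ᵈ *ᵈ sign (1 + m) *ᵈ pathDet (1 + m))
      ≡⟨ solve 3 (λ x s p → x :* (con 1ᵈ :* con 1ᵈ :* con 0ᵈ) :+ con (-ᵈ 1ᵈ) :* (con 1ᵈ :* s :* p) := :- (s :* p))
               refl (X₂ 0 0) (sign (1 + m)) (pathDet (1 + m)) ⟩
    -ᵈ (sign (1 + m) *ᵈ pathDet (1 + m)) ∎
    where
    open ≡-Reasoning
    3+<K : ∀ {a} → a < 1 + m → 3 + a < K
    3+<K a<1+m = s≤s (s≤s (s≤s a<1+m))
    others : ∀ {s} → s < 2 + m → s ≢ 0 → s ≢ 1 + m → X₂ 0 s ≡ 0ᵈ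
    others s<2+m s≢0 s≢1+m = trans (entry-path (s≤s (s≤s (s≤s z≤n))) (3+<K (<suc∧≢⇒< s<2+m s≢1+m)))
                                   (cong (λ b → weight false (b ∨ false)) (≢⇒≡ᵇ-false (s≢0 ∘ sym)))
    deleted≈0 : det (1 + m) (indexed (1 + m) (strike 0 0 X₂)) ≡ 0ᵈ
    deleted≈0 = det-indexed-zeroColumn m (strike 0 0 X₂) (n<1+n m) λ a<1+m →
      trans (cong (λ r → entry r K) (skip-< (3+<K a<1+m))) (entry-path-K (3+<K a<1+m) λ ())
    remaining≈path : det (1 + m) (indexed (1 + m) (strike 0 (1 + m) X₂)) ≡ pathDet (1 + m)
    remaining≈path = det-indexed-cong (1 + m) λ a<1+m b<1+m →
      trans (cong₂ entry (skip-< (3+<K a<1+m)) (cong (λ b → 3 + b) (skip-< b<1+m))) (entry-path (3+<K a<1+m) (3+<K b<1+m))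

  ε*det-Xₘ : ε *ᵈ det (4 + m) (indexed (4 + m) Xₘ) ≡ -ᵈ (ε *ᵈ det (2 + m) (indexed (2 + m) X₂))
  ε*det-Xₘ = begin
    ε *ᵈ det (4 + m) (indexed (4 + m) Xₘ)
      ≡⟨ cong (ε *ᵈ_) (det-pendantFirst (indexed (4 + m) Xₘ) firstRow firstColumn) ⟩
    ε *ᵈ (Xₘ 0 0 *ᵈ Y -ᵈ Xₘ 0 1 *ᵈ (Xₘ 1 0 *ᵈ D))
      ≡⟨ cong (λ x → ε *ᵈ (x *ᵈ Y -ᵈ Xₘ 0 1 *ᵈ (Xₘ 1 0 *ᵈ D))) (entry-path (s≤s z≤n) (s≤s z≤n)) ⟩
    ε *ᵈ (ε *ᵈ Y -ᵈ Xₘ 0 1 *ᵈ (Xₘ 1 0 *ᵈ D))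
      ≡⟨ solve 4 (λ y a b d → con ε :* (con ε :* y :+ :- (a :* (b :* d))) := :- (a :* b :* (con ε :* d)))
               refl Y (Xₘ 0 1) (Xₘ 1 0) D ⟩
    -ᵈ (Xₘ 0 1 *ᵈ Xₘ 1 0 *ᵈ (ε *ᵈ D))
      ≡⟨ cong₂ (λ x y → -ᵈ (x *ᵈ y *ᵈ (ε *ᵈ D))) (entry-path (s≤s z≤n) (s≤s (s≤s z≤n))) (entry-path (s≤s (s≤s z≤n)) (s≤s z≤n)) ⟩
    -ᵈ (-ᵈ 1ᵈ *ᵈ -ᵈ 1ᵈ *ᵈ (ε *ᵈ D))
      ≡⟨ solve 1 (λ d → :- (con (-ᵈ 1ᵈ) :* con (-ᵈ 1ᵈ) :* (con ε :* d)) := :- (con ε :* d)) refl D ⟩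
    -ᵈ (ε *ᵈ D) ∎
    where
    open ≡-Reasoning
    Y D : Dual
    Y = det (3 + m) (λ r s → indexed (4 + m) Xₘ (suc r) (suc s))
    D = det (2 + m) (indexed (2 + m) X₂)
    firstRow : ∀ s → indexed (4 + m) Xₘ zero (suc (suc s)) ≡ 0ᵈ
    firstRow s with m≤n⇒m<n∨m≡n (≤-pred (toℕ<n s))
    ... | inj₁ t<1+m = entry-path (s≤s z≤n) (s≤s (s≤s (s≤s t<1+m)))
    ... | inj₂ t≡1+m = trans (cong (λ t → entry 0 (3 + t)) t≡1+m) (entry-path-K (s≤s z≤n) λ ())
    firstColumn : ∀ r → indexed (4 + m) Xₘ (suc (suc r)) zero ≡ 0ᵈ
    firstColumn r = trans (cong (λ a → entry a 0) (skip-< (s≤s (s≤s (toℕ<n r)))))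
                          (entry-path (s≤s (s≤s (toℕ<n r))) (s≤s z≤n))

  ε*det-withoutLast : ε *ᵈ det (5 + m) (indexed (5 + m) entry) ≡ ε *ᵈ pathDet (1 + m)
  ε*det-withoutLast = begin
    ε *ᵈ det (5 + m) (indexed (5 + m) entry)
      ≡⟨ cong (ε *ᵈ_) (det-indexed-twoEntryRow (4 + m) entry (n<1+n K) (n<1+n K) (s≤s (s≤s (s≤s z≤n))) (λ ()) others) ⟩
    ε *ᵈ (entry K K *ᵈ (sign K *ᵈ sign K *ᵈ Y) +ᵈ entry K 2 *ᵈ (sign K *ᵈ sign 2 *ᵈ Z))
      ≡⟨ cong₂ (λ x y → ε *ᵈ (x *ᵈ (sign K *ᵈ sign K *ᵈ Y) +ᵈ y *ᵈ (sign K *ᵈ sign 2 *ᵈ Z))) entry-K-K entry-K-2 ⟩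
    ε *ᵈ (ε *ᵈ (sign K *ᵈ sign K *ᵈ Y) +ᵈ -ᵈ 1ᵈ *ᵈ (sign K *ᵈ sign 2 *ᵈ Z))
      ≡⟨ solve 3 (λ y s z → con ε :* (con ε :* (s :* s :* y) :+ con (-ᵈ 1ᵈ) :* (s :* con 1ᵈ :* z)) := :- s :* (con ε :* z))
               refl Y (sign K) Z ⟩
    -ᵈ sign K *ᵈ (ε *ᵈ Z)
      ≡⟨ cong (-ᵈ sign K *ᵈ_) (trans ε*det-Xₘ (cong (λ d → -ᵈ (ε *ᵈ d)) det-X₂)) ⟩
    -ᵈ sign K *ᵈ -ᵈ (ε *ᵈ -ᵈ (sign (1 + m) *ᵈ pathDet (1 + m)))
      ≡⟨ solve 2 (λ s p → :- (:- :- :- :- s) :* :- (con ε :* :- (:- s :* p)) := s :* s :* (con ε :* p))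
               refl (sign m) (pathDet (1 + m)) ⟩
    sign m *ᵈ sign m *ᵈ (ε *ᵈ pathDet (1 + m))
      ≡⟨ trans (cong (_*ᵈ (ε *ᵈ pathDet (1 + m))) (sign-square m)) (*-identityˡ _) ⟩
    ε *ᵈ pathDet (1 + m) ∎
    where
    open ≡-Reasoning
    Y Z : Dual
    Y = det (4 + m) (indexed (4 + m) (strike K K entry))
    Z = det (4 + m) (indexed (4 + m) Xₘ)
    others : ∀ {s} → s < 5 + m → s ≢ K → s ≢ 2 → entry K s ≡ 0ᵈ
    others s<L s≢K s≢2 = entry-K-path (<suc∧≢⇒< s<L s≢K) s≢2

  det-charMatrix-mod-ε² : det (6 + m) (indexed (6 + m) entry) ≡ ε *ᵈ pathDet (1 + m) -ᵈ pathDet (4 + m)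
  det-charMatrix-mod-ε² = trans det-charMatrix (cong (_-ᵈ pathDet K) ε*det-withoutLast)

truncate-charPoly-T : ∀ m {a b c d} → pathDet (1 + m) ≡ (a , b) → pathDet (4 + m) ≡ (c , d) →
                      truncate (charPoly (6 + m) (T (6 + m))) ≡ (- c , a -ℤ d)
truncate-charPoly-T m {a} {b} {c} {d} P₁₊ₘ P₄₊ₘ = begin
  truncate (charPoly (6 + m) (T (6 + m)))   ≡⟨ truncate-charPoly (6 + m) (T (6 + m)) ⟩
  det (6 + m) (indexed (6 + m) entry)       ≡⟨ det-charMatrix-mod-ε² ⟩
  ε *ᵈ pathDet (1 + m) -ᵈ pathDet (4 + m)   ≡⟨ cong₂ (λ x y → ε *ᵈ x -ᵈ y) P₁₊ₘ P₄₊ₘ ⟩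
  ε *ᵈ (a , b) -ᵈ (c , d)                   ≡⟨ ε-shift a b c d ⟩
  (- c , a -ℤ d)                            ∎
  where
  open ≡-Reasoning
  open Adjacency m using (entry)
  open TreeDeterminant m using (det-charMatrix-mod-ε²)

lowestTerm-constant : ∀ p {a b} → truncate p ≡ (a , b) → a ≢ 0ℤ → lowestTerm p ≡ just (0 , a)
lowestTerm-constant []             refl a≢0 = ⊥-elim (a≢0 refl)
lowestTerm-constant (+ zero  ∷ p)  refl a≢0 = ⊥-elim (a≢0 refl)
lowestTerm-constant (+ suc k ∷ p)  refl _   = refl
lowestTerm-constant (-[1+ k ] ∷ p) refl _   = refl

lowestTerm-linear : ∀ p {b} → truncate p ≡ (0ℤ , b) → b ≢ 0ℤ → lowestTerm p ≡ just (1 , b)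
lowestTerm-linear []                      refl b≢0 = ⊥-elim (b≢0 refl)
lowestTerm-linear (+ zero ∷ [])           refl b≢0 = ⊥-elim (b≢0 refl)
lowestTerm-linear (+ zero ∷ + zero ∷ p)   refl b≢0 = ⊥-elim (b≢0 refl)
lowestTerm-linear (+ zero ∷ + suc k ∷ p)  refl _   = refl
lowestTerm-linear (+ zero ∷ -[1+ k ] ∷ p) refl _   = refl
lowestTerm-linear (+ suc k ∷ p)           ()   _
lowestTerm-linear (-[1+ k ] ∷ p)          ()   _

pathDet-cong : ∀ {m m′} (f : ℕ → ℕ) {x} → m ≡ m′ → pathDet (f m′) ≡ x → pathDet (f m) ≡ x
pathDet-cong f m≡m′ = trans (cong (λ k → pathDet (f k)) m≡m′)

module _ (m : ℕ) where
  private
    φ : Poly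
    φ = charPoly (6 + m) (T (6 + m))

    4s+0 : ∀ t → 4 * (2 + t) ≡ 6 + (2 + t * 4)
    4s+0 = ℕ-Solver.solve-∀
    4s+1 : ∀ t → 4 * (2 + t) + 1 ≡ 6 + (3 + t * 4)
    4s+1 = ℕ-Solver.solve-∀
    4s+2 : ∀ t → 4 * (1 + t) + 2 ≡ 6 + t * 4
    4s+2 = ℕ-Solver.solve-∀
    4s+3 : ∀ t → 4 * (1 + t) + 3 ≡ 6 + (1 + t * 4)
    4s+3 = ℕ-Solver.solve-∀

  lowestTerm-4s : ∀ s → 6 + m ≡ 4 * s → lowestTerm φ ≡ just (0 , + 1)
  lowestTerm-4s zero          ()
  lowestTerm-4s (suc zero)    ()
  lowestTerm-4s (suc (suc t)) eq = lowestTerm-constant φ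
    (truncate-charPoly-T m (pathDet-cong (λ k → 1 + k) m≡ (proj₂ (proj₂ (proj₂ (pathDet-periodic t)))))
                           (pathDet-cong (λ k → 4 + k) m≡ (proj₁ (proj₂ (proj₂ (pathDet-periodic (suc t)))))))
    λ ()
    where
    m≡ : m ≡ 2 + t * 4
    m≡ = +-cancelˡ-≡ 6 m (2 + t * 4) (trans eq (4s+0 t))

  lowestTerm-4s+1 : ∀ s → 6 + m ≡ 4 * s + 1 → lowestTerm φ ≡ just (1 , + (2 * s + 1))
  lowestTerm-4s+1 zero          ()
  lowestTerm-4s+1 (suc zero)    ()
  lowestTerm-4s+1 (suc (suc t)) eq = lowestTerm-linear φ
    (trans (truncate-charPoly-T m (pathDet-cong (λ k → 1 + k) m≡ (proj₁ (pathDet-periodic (suc t))))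
                                  (pathDet-cong (λ k → 4 + k) m≡ (proj₂ (proj₂ (proj₂ (pathDet-periodic (suc t)))))))
           (cong (0ℤ ,_) (odd-after-even (suc t))))
    λ ()
    where
    m≡ : m ≡ 3 + t * 4
    m≡ = +-cancelˡ-≡ 6 m (3 + t * 4) (trans eq (4s+1 t))

  lowestTerm-4s+2 : ∀ s → 6 + m ≡ 4 * s + 2 → lowestTerm φ ≡ just (0 , - (+ 1))
  lowestTerm-4s+2 zero    ()
  lowestTerm-4s+2 (suc t) eq = lowestTerm-constant φ
    (truncate-charPoly-T m (pathDet-cong (λ k → 1 + k) m≡ (proj₁ (proj₂ (pathDet-periodic t))))
                           (pathDet-cong (λ k → 4 + k) m≡ (proj₁ (pathDet-periodic (suc t)))))
    λ ()
    where
    m≡ : m ≡ t * 4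
    m≡ = +-cancelˡ-≡ 6 m (t * 4) (trans eq (4s+2 t))

  lowestTerm-4s+3 : ∀ s → 6 + m ≡ 4 * s + 3 → lowestTerm φ ≡ just (1 , - (+ (2 * (s + 1))))
  lowestTerm-4s+3 zero    ()
  lowestTerm-4s+3 (suc t) eq = lowestTerm-linear φ
    (trans (truncate-charPoly-T m (pathDet-cong (λ k → 1 + k) m≡ (proj₁ (proj₂ (proj₂ (pathDet-periodic t)))))
                                  (pathDet-cong (λ k → 4 + k) m≡ (proj₁ (proj₂ (pathDet-periodic (suc t))))))
           (cong (0ℤ ,_) (even-after-odd (suc t))))
    λ ()
    where
    m≡ : m ≡ 1 + t * 4
    m≡ = +-cancelˡ-≡ 6 m (1 + t * 4) (trans eq (4s+3 t))

proposition2p16 : (n s : ℕ) → 6 ≤ n →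
    (n ≡ 4 * s → lowestTerm (charPoly n (T n)) ≡ just (0 , + 1))
    × (n ≡ 4 * s + 1 → lowestTerm (charPoly n (T n)) ≡ just (1 , + (2 * s + 1)))
    × (n ≡ 4 * s + 2 → lowestTerm (charPoly n (T n)) ≡ just (0 , - (+ 1)))
    × (n ≡ 4 * s + 3 → lowestTerm (charPoly n (T n)) ≡ just (1 , - (+ (2 * (s + 1)))))
proposition2p16 _ s (s≤s (s≤s (s≤s (s≤s (s≤s (s≤s (z≤n {m}))))))) =
  lowestTerm-4s m s , lowestTerm-4s+1 m s , lowestTerm-4s+2 m s , lowestTerm-4s+3 m s
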